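{- Let $M$ be a proper equicardinal set system over $V$. Then the following are equivalent: (i) $P_M(y)=0$; (ii) the degree of $P_M(y)$ is smaller than $d_{M*V}$; (iii) $M+X=M$ for some $X\subseteq V$ with $|X|$ odd.
   Context: A set system $M=(V,D)$ is proper if $D\neq\emptyset$ and equicardinal if all members of $D$ have the same cardinality. Twist $M*X=(V,\{Y\triangle X:Y\in D\})$; loop complementation $M+X=(V,D')$ with $Y\in D'$ iff the number of $W\in D$ with $Y\setminus X\subseteq W\subseteq Y$ is odd; dual pivot $M\bar{*}X=(V,D'')$ with $Y\in D''$ iff the number of $W\in D$ with $Y\subseteq W\subseteq Y\cup X$ is odd; operations are applied left to right. $d_M=\min\{|Y|:Y\in D\}$ (taken to be $+\infty$... not needed if nonempty). The Penrose polynomial is $P_M(y)=\sum_{X\subseteq V}(-1)^{|X|}y^{d_{M*V\bar{*}X}}$, where a term whose set system $M*V\bar*X$ has empty family contributes nothing. The zero polynomial is regarded as having degree smaller than any integer. -}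

module Defs where

open import Data.Nat using (ℕ; zero; suc; _⊓_; _≡ᵇ_)
open import Data.Bool using (Bool; true; false; if_then_else_; _xor_; _∧_; not)
open import Data.Integer using (ℤ; +_; -_)
import Data.Integer as ℤ
open import Data.List using (List; []; _∷_; map; _++_; foldr)
open import Data.Bool.ListAction using (any)
open import Data.Vec using (Vec; []; _∷_; zipWith)
open import Data.Fin.Subset using (Subset; ⊤; _∪_; _─_; ∣_∣)
open import Data.Fin.Subset.Properties using (_⊆?_)
open import Relation.Nullary using (does)
open import Relation.Binary.PropositionalEquality using (_≡_)
open import Data.Product using (∃)

-- A set system over V = Fin n: the family D is given by its
-- characteristic function on subsets of V.
SetSys : ℕ → Set
SetSys n = Subset n → Bool

allSubsets : ∀ n → List (Subset n)
allSubsets zero = [] ∷ []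
allSubsets (suc n) = map (true ∷_) (allSubsets n) ++ map (false ∷_) (allSubsets n)

_△_ : ∀ {n} → Subset n → Subset n → Subset n
X △ Y = zipWith _xor_ X Y

oddCount : ∀ {n} → (Subset n → Bool) → Bool
oddCount {n} P = foldr (λ W acc → P W xor acc) false (allSubsets n)

_⊆ᵇ_ : ∀ {n} → Subset n → Subset n → Bool
X ⊆ᵇ Y = does (X ⊆? Y)

twist : ∀ {n} → SetSys n → Subset n → SetSys n
twist M X Y = M (Y △ X)

loopCompl : ∀ {n} → SetSys n → Subset n → SetSys n
loopCompl M X Y = oddCount (λ W → M W ∧ ((Y ─ X) ⊆ᵇ W) ∧ (W ⊆ᵇ Y))

dualPivot : ∀ {n} → SetSys n → Subset n → SetSys n
dualPivot M X Y = oddCount (λ W → M W ∧ (Y ⊆ᵇ W) ∧ (W ⊆ᵇ (Y ∪ X)))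

Proper : ∀ {n} → SetSys n → Set
Proper M = ∃ λ Y → M Y ≡ true

Equicardinal : ∀ {n} → SetSys n → Set
Equicardinal M = ∀ Y Z → M Y ≡ true → M Z ≡ true → ∣ Y ∣ ≡ ∣ Z ∣

nonemptyᵇ : ∀ {n} → SetSys n → Bool
nonemptyᵇ {n} M = any M (allSubsets n)

-- d_M = min{|Y| : Y ∈ D} (the correct value whenever D is nonempty,
-- since every cardinality is ≤ n)
dmin : ∀ {n} → SetSys n → ℕ
dmin {n} M = foldr (λ Y acc → if M Y then ∣ Y ∣ ⊓ acc else acc) n (allSubsets n)

sumℤ : List ℤ → ℤ
sumℤ = foldr ℤ._+_ (+ 0)

sign : ∀ {n} → Subset n → ℤ
sign X = if ∣ X ∣ Data.Nat.% 2 ≡ᵇ 0 then + 1 else - (+ 1)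

-- The Penrose polynomial P_M(y), represented by its coefficient sequence:
-- penroseCoeff M k is the coefficient of y^k in
--   Σ_{X ⊆ V} (-1)^{|X|} y^{d_{M*V \bar* X}},
-- where terms with empty family contribute nothing.
penroseCoeff : ∀ {n} → SetSys n → ℕ → ℤ
penroseCoeff {n} M k =
  sumℤ (map (λ X → let N = dualPivot (twist M ⊤) X in
                   if nonemptyᵇ N ∧ (dmin N ≡ᵇ k) then sign X else + 0)
            (allSubsets n))

PenroseZero : ∀ {n} → SetSys n → Set
PenroseZero M = ∀ k → penroseCoeff M k ≡ + 0

-- deg P < d (zero polynomial has degree below every integer)
PenroseDegLt : ∀ {n} → SetSys n → ℕ → Set
PenroseDegLt M d = ∀ k → d Data.Nat.≤ k → penroseCoeff M k ≡ + 0

module Submission where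

-- Everything is done over GF(2) (Booleans with xor).  We first show that loop
-- complementation is a GF(2)-linear action of (2^V, △):  M + ∅ = M and
-- (M + X) + Y = M + (X △ Y), and that the X-th set system in the Penrose sum is
-- M*V ∗̄ X = (M + X) * V.
--
-- (iii) ⇒ (i): if M + X₀ = M with |X₀| odd, then X ↦ X₀ △ X leaves the set
-- system of every term unchanged and flips its sign, so all coefficients vanish.
-- (ii) ⇒ (iii): let M have rank r, so m = d_{M*V} ≥ |V| - r.  Loop
-- complementation never changes membership of sets of size ≤ r, so a term of
-- degree m, whose system M + X has no member larger than r, has M + X = M.
-- Without an odd such X all degree-m terms are +1 or 0, and X = ∅ gives +1,
-- so the coefficient of y^m is positive.  (i) ⇒ (ii) is immediate.

open import Defs
open import Data.Nat using (ℕ; _%_)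
open import Data.Fin.Subset using (Subset; ⊤; ∣_∣)
open import Data.Product using (_×_; ∃)
open import Function.Bundles using (_⇔_)
open import Relation.Binary.PropositionalEquality using (_≡_)

open import Algebra.Bundles using (CommutativeRing)
open import Data.Bool using (Bool; true; false; not; _∧_; _xor_; if_then_else_)
open import Data.Bool.ListAction using (any; or)
open import Data.Bool.Properties as Bool
  using (xor-assoc; xor-comm; T-∧; xor-identityʳ; not-distribˡ-xor; not-distribʳ-xor; not-involutive;
         ∧-assoc; ∧-zeroʳ; ∧-identityʳ; ∧-distribʳ-xor; ∨-zeroʳ; ¬-not; T-≡; xor-∧-commutativeRing)
open import Algebra.Properties.CommutativeSemigroup
  (CommutativeRing.+-commutativeSemigroup xor-∧-commutativeRing) using (interchange)
open import Data.Empty using (⊥-elim)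
open import Data.Fin.Subset using (_─_; _∪_) renaming (⊥ to ∅)
open import Data.Fin.Subset.Properties using (anySubset?; ∣p∣≤n; ∣⊥∣≡0)
open import Data.Integer as ℤ using (ℤ; +_; -_; -[1+_])
import Data.Integer.Properties as ℤ
open import Data.List using (List; []; _∷_; map; _++_; foldr)
open import Data.List.Membership.Propositional using (_∈_)
open import Data.List.Membership.Propositional.Properties using (∈-map⁺; ∈-++⁺ˡ; ∈-++⁺ʳ)
open import Data.List.Properties using (foldr-map; map-cong; map-++; map-∘)
open import Data.List.Relation.Unary.Any using (here; there)
open import Data.Nat using (zero; suc; _+_; _≤_; _⊓_; _≡ᵇ_; _≤?_; z≤n; s≤s)
import Data.Nat.Properties as ℕ
open import Data.Nat.DivMod using ([m+n]%n≡m%n)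
open import Data.Product using (_,_; proj₂)
open import Data.Vec using (_∷_; [])
open import Data.Vec.Properties using (∷-injectiveʳ)
open import Function using (_∘_)
open import Function.Bundles using (mk⇔; Equivalence)
open import Relation.Binary.PropositionalEquality
  using (_≢_; refl; sym; trans; cong; cong₂; subst; module ≡-Reasoning)
open import Relation.Nullary using (¬_; Dec; yes; no; contradiction)
open import Relation.Nullary.Decidable using (¬?; _×-dec_; decidable-stable)
open ≡-Reasoning

xor-interchange : ∀ a b c d → (a xor b) xor (c xor d) ≡ (a xor c) xor (b xor d)
xor-interchange = interchange

∧-false₃ : ∀ a b → a ∧ (b ∧ false) ≡ false
∧-false₃ a b = trans (cong (a ∧_) (∧-zeroʳ b)) (∧-zeroʳ a)

-- Parities of counts

-- Does an odd number of entries of l satisfy P?  By definition,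
-- oddCount P is parityOf P (allSubsets n).
parityOf : {A : Set} → (A → Bool) → List A → Bool
parityOf P = foldr (λ W acc → P W xor acc) false

parityOf-cong : ∀ {A : Set} {P Q : A → Bool} (l : List A) →
  (∀ x → P x ≡ Q x) → parityOf P l ≡ parityOf Q l
parityOf-cong [] eq = refl
parityOf-cong (x ∷ l) eq = cong₂ _xor_ (eq x) (parityOf-cong l eq)

parityOf-none : ∀ {A : Set} {P : A → Bool} (l : List A) →
  (∀ x → P x ≡ false) → parityOf P l ≡ false
parityOf-none [] none = refl
parityOf-none (x ∷ l) none = cong₂ _xor_ (none x) (parityOf-none l none)

parityOf-xor : ∀ {A : Set} (P Q : A → Bool) (l : List A) →
  parityOf (λ x → P x xor Q x) l ≡ parityOf P l xor parityOf Q l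
parityOf-xor P Q [] = refl
parityOf-xor P Q (x ∷ l) = begin
  (P x xor Q x) xor parityOf (λ x → P x xor Q x) l
    ≡⟨ cong ((P x xor Q x) xor_) (parityOf-xor P Q l) ⟩
  (P x xor Q x) xor (parityOf P l xor parityOf Q l)
    ≡⟨ xor-interchange (P x) (Q x) _ _ ⟩
  (P x xor parityOf P l) xor (Q x xor parityOf Q l) ∎

parityOf-scale : ∀ {A : Set} (c : Bool) (P : A → Bool) (l : List A) →
  parityOf (λ x → c ∧ P x) l ≡ c ∧ parityOf P l
parityOf-scale false P l = parityOf-none l (λ _ → refl)
parityOf-scale true P l = refl

parityOf-++ : ∀ {A : Set} (P : A → Bool) (xs ys : List A) →
  parityOf P (xs ++ ys) ≡ parityOf P xs xor parityOf P ys
parityOf-++ P [] ys = refl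
parityOf-++ P (x ∷ xs) ys =
  trans (cong (P x xor_) (parityOf-++ P xs ys)) (sym (xor-assoc (P x) _ _))

oddCount-split : ∀ {n} (P : Subset (suc n) → Bool) →
  oddCount P ≡ oddCount (λ W → P (true ∷ W)) xor oddCount (λ W → P (false ∷ W))
oddCount-split {n} P = begin
  parityOf P (map (true ∷_) subsets ++ map (false ∷_) subsets)
    ≡⟨ parityOf-++ P (map (true ∷_) subsets) _ ⟩
  parityOf P (map (true ∷_) subsets) xor parityOf P (map (false ∷_) subsets)
    ≡⟨ cong₂ _xor_ (foldr-map _ (true ∷_) false subsets) (foldr-map _ (false ∷_) false subsets) ⟩
  oddCount (λ W → P (true ∷ W)) xor oddCount (λ W → P (false ∷ W)) ∎
  where
  subsets : List (Subset n)
  subsets = allSubsets n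

oddCount-unique : ∀ {n} (P : Subset n → Bool) (Y : Subset n) →
  (∀ W → W ≢ Y → P W ≡ false) → oddCount P ≡ P Y
oddCount-unique P [] others = xor-identityʳ (P [])
oddCount-unique {suc n} P (true ∷ Y) others = begin
  oddCount P
    ≡⟨ oddCount-split P ⟩
  oddCount (λ W → P (true ∷ W)) xor oddCount (λ W → P (false ∷ W))
    ≡⟨ cong₂ _xor_ (oddCount-unique (λ W → P (true ∷ W)) Y (λ W W≢Y → others _ (W≢Y ∘ ∷-injectiveʳ)))
                   (parityOf-none (allSubsets n) (λ W → others _ λ ())) ⟩
  P (true ∷ Y) xor false
    ≡⟨ xor-identityʳ _ ⟩
  P (true ∷ Y) ∎
oddCount-unique {suc n} P (false ∷ Y) others = begin
  oddCount P
    ≡⟨ oddCount-split P ⟩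
  oddCount (λ W → P (true ∷ W)) xor oddCount (λ W → P (false ∷ W))
    ≡⟨ cong₂ _xor_ (parityOf-none (allSubsets n) (λ W → others _ λ ()))
                   (oddCount-unique (λ W → P (false ∷ W)) Y (λ W W≢Y → others _ (W≢Y ∘ ∷-injectiveʳ))) ⟩
  P (false ∷ Y) ∎

-- Loop complementation and dual pivot, one element at a time

_↓_ : ∀ {n} → SetSys (suc n) → Bool → SetSys n
(M ↓ b) W = M (b ∷ W)

loopTerms : ∀ {n} → SetSys n → Subset n → Subset n → Subset n → Bool
loopTerms M X Y W = M W ∧ ((Y ─ X) ⊆ᵇ W) ∧ (W ⊆ᵇ Y)

pivotTerms : ∀ {n} → SetSys n → Subset n → Subset n → Subset n → Bool
pivotTerms K X Y W = K W ∧ (Y ⊆ᵇ W) ∧ (W ⊆ᵇ (Y ∪ X))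

-- A set avoiding the first element only sees the sets avoiding it.
loop-outside : ∀ {n} (M : SetSys (suc n)) x X Z →
  loopCompl M (x ∷ X) (false ∷ Z) ≡ loopCompl (M ↓ false) X Z
loop-outside {n} M x X Z = trans (oddCount-split (loopTerms M (x ∷ X) (false ∷ Z)))
  (cong₂ _xor_ (parityOf-none (allSubsets n) (λ W → ∧-false₃ (M (true ∷ W)) _))
               (parityOf-cong (allSubsets n) (λ W → cong (λ s → M (false ∷ W) ∧ s ∧ (W ⊆ᵇ Z)) (first-outside x W))))
  where
  first-outside : ∀ x W → (((false ∷ Z) ─ (x ∷ X)) ⊆ᵇ (false ∷ W)) ≡ ((Z ─ X) ⊆ᵇ W)
  first-outside true W = refl
  first-outside false W = refl

-- A set containing the first element sees the sets containing it, and also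
-- those avoiding it when the first element belongs to X.
loop-inside : ∀ {n} (M : SetSys (suc n)) x X Z →
  loopCompl M (x ∷ X) (true ∷ Z) ≡ loopCompl (M ↓ true) X Z xor (x ∧ loopCompl (M ↓ false) X Z)
loop-inside M true X Z = oddCount-split (loopTerms M (true ∷ X) (true ∷ Z))
loop-inside M false X Z = trans (oddCount-split (loopTerms M (false ∷ X) (true ∷ Z)))
  (cong (loopCompl (M ↓ true) X Z xor_) (parityOf-none (allSubsets _) (λ W → ∧-zeroʳ (M (false ∷ W)))))

pivot-inside : ∀ {n} (K : SetSys (suc n)) x X Y →
  dualPivot K (x ∷ X) (true ∷ Y) ≡ dualPivot (K ↓ true) X Y
pivot-inside K x X Y = trans (oddCount-split (pivotTerms K (x ∷ X) (true ∷ Y)))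
  (trans (cong (dualPivot (K ↓ true) X Y xor_) (parityOf-none (allSubsets _) (λ W → ∧-zeroʳ (K (false ∷ W)))))
         (xor-identityʳ _))

pivot-outside : ∀ {n} (K : SetSys (suc n)) x X Y →
  dualPivot K (x ∷ X) (false ∷ Y) ≡ dualPivot (K ↓ false) X Y xor (x ∧ dualPivot (K ↓ true) X Y)
pivot-outside K true X Y = trans (oddCount-split (pivotTerms K (true ∷ X) (false ∷ Y)))
  (xor-comm (dualPivot (K ↓ true) X Y) _)
pivot-outside K false X Y = trans (oddCount-split (pivotTerms K (false ∷ X) (false ∷ Y)))
  (trans (cong (_xor dualPivot (K ↓ false) X Y) (parityOf-none (allSubsets _) (λ W → ∧-false₃ (K (true ∷ W)) _)))
         (sym (xor-identityʳ _)))

-- Loop complementation is a linear action of (2^V, △) on set systems over GF(2)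

loopCompl-cong : ∀ {n} {M M′ : SetSys n} → (∀ W → M W ≡ M′ W) →
  ∀ X Z → loopCompl M X Z ≡ loopCompl M′ X Z
loopCompl-cong {n} M≗M′ X Z = parityOf-cong (allSubsets n) (λ W → cong (_∧ _) (M≗M′ W))

loopCompl-linear : ∀ {n} (A B : SetSys n) (c : Bool) X Z →
  loopCompl (λ W → A W xor (c ∧ B W)) X Z ≡ loopCompl A X Z xor (c ∧ loopCompl B X Z)
loopCompl-linear {n} A B c X Z = begin
  parityOf (λ W → (A W xor (c ∧ B W)) ∧ rest W) subsets
    ≡⟨ parityOf-cong subsets distribute ⟩
  parityOf (λ W → loopTerms A X Z W xor (c ∧ loopTerms B X Z W)) subsets
    ≡⟨ parityOf-xor (loopTerms A X Z) _ subsets ⟩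
  loopCompl A X Z xor parityOf (λ W → c ∧ loopTerms B X Z W) subsets
    ≡⟨ cong (loopCompl A X Z xor_) (parityOf-scale c (loopTerms B X Z) subsets) ⟩
  loopCompl A X Z xor (c ∧ loopCompl B X Z) ∎
  where
  subsets : List (Subset n)
  subsets = allSubsets n
  rest : Subset n → Bool
  rest W = ((Z ─ X) ⊆ᵇ W) ∧ (W ⊆ᵇ Z)
  distribute : ∀ W → (A W xor (c ∧ B W)) ∧ rest W ≡ (A W ∧ rest W) xor (c ∧ (B W ∧ rest W))
  distribute W = trans (∧-distribʳ-xor (rest W) (A W) _) (cong (A W ∧ rest W xor_) (∧-assoc c (B W) (rest W)))

loopCompl-∅ : ∀ {n} (M : SetSys n) Y → loopCompl M ∅ Y ≡ M Y
loopCompl-∅ M [] = trans (xor-identityʳ _) (∧-identityʳ (M []))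
loopCompl-∅ M (false ∷ Y) = trans (loop-outside M false ∅ Y) (loopCompl-∅ (M ↓ false) Y)
loopCompl-∅ M (true ∷ Y) = begin
  loopCompl M (false ∷ ∅) (true ∷ Y)     ≡⟨ loop-inside M false ∅ Y ⟩
  loopCompl (M ↓ true) ∅ Y xor false     ≡⟨ xor-identityʳ _ ⟩
  loopCompl (M ↓ true) ∅ Y               ≡⟨ loopCompl-∅ (M ↓ true) Y ⟩
  M (true ∷ Y) ∎

loopCompl-∘ : ∀ {n} (M : SetSys n) X X′ Z → loopCompl (loopCompl M X) X′ Z ≡ loopCompl M (X △ X′) Z
loopCompl-∘ M [] [] [] = loopCompl-∅ (loopCompl M []) []
loopCompl-∘ M (x ∷ X) (x′ ∷ X′) (false ∷ Z) = begin
  loopCompl (loopCompl M (x ∷ X)) (x′ ∷ X′) (false ∷ Z)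
    ≡⟨ loop-outside (loopCompl M (x ∷ X)) x′ X′ Z ⟩
  loopCompl (loopCompl M (x ∷ X) ↓ false) X′ Z
    ≡⟨ loopCompl-cong (loop-outside M x X) X′ Z ⟩
  loopCompl (loopCompl (M ↓ false) X) X′ Z
    ≡⟨ loopCompl-∘ (M ↓ false) X X′ Z ⟩
  loopCompl (M ↓ false) (X △ X′) Z
    ≡⟨ loop-outside M (x xor x′) (X △ X′) Z ⟨
  loopCompl M ((x ∷ X) △ (x′ ∷ X′)) (false ∷ Z) ∎
loopCompl-∘ {suc n} M (x ∷ X) (x′ ∷ X′) (true ∷ Z) = begin
  loopCompl (loopCompl M (x ∷ X)) (x′ ∷ X′) (true ∷ Z)
    ≡⟨ loop-inside (loopCompl M (x ∷ X)) x′ X′ Z ⟩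
  loopCompl (loopCompl M (x ∷ X) ↓ true) X′ Z xor (x′ ∧ loopCompl (loopCompl M (x ∷ X) ↓ false) X′ Z)
    ≡⟨ cong₂ (λ A B → A xor (x′ ∧ B)) (loopCompl-cong (loop-inside M x X) X′ Z)
                                      (loopCompl-cong (loop-outside M x X) X′ Z) ⟩
  loopCompl (λ W → T W xor (x ∧ F W)) X′ Z xor (x′ ∧ loopCompl F X′ Z)
    ≡⟨ cong (_xor (x′ ∧ loopCompl F X′ Z)) (loopCompl-linear T F x X′ Z) ⟩
  (loopCompl T X′ Z xor (x ∧ loopCompl F X′ Z)) xor (x′ ∧ loopCompl F X′ Z)
    ≡⟨ cong₂ (λ a b → (a xor (x ∧ b)) xor (x′ ∧ b)) (loopCompl-∘ (M ↓ true) X X′ Z)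
                                                   (loopCompl-∘ (M ↓ false) X X′ Z) ⟩
  (loopCompl (M ↓ true) (X △ X′) Z xor (x ∧ f)) xor (x′ ∧ f)
    ≡⟨ xor-assoc (loopCompl (M ↓ true) (X △ X′) Z) _ _ ⟩
  loopCompl (M ↓ true) (X △ X′) Z xor ((x ∧ f) xor (x′ ∧ f))
    ≡⟨ cong (loopCompl (M ↓ true) (X △ X′) Z xor_) (∧-distribʳ-xor f x x′) ⟨
  loopCompl (M ↓ true) (X △ X′) Z xor ((x xor x′) ∧ f)
    ≡⟨ loop-inside M (x xor x′) (X △ X′) Z ⟨
  loopCompl M ((x ∷ X) △ (x′ ∷ X′)) (true ∷ Z) ∎
  where
  T F : SetSys n
  T = loopCompl (M ↓ true) X
  F = loopCompl (M ↓ false) X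
  f : Bool
  f = loopCompl (M ↓ false) (X △ X′) Z

-- The X-th set system of the Penrose sum is a twist of a loop complement:
-- M * V ∗̄ X = (M + X) * V.
dualPivot-twist : ∀ {n} (M : SetSys n) X Y → dualPivot (twist M ⊤) X Y ≡ twist (loopCompl M X) ⊤ Y
dualPivot-twist M [] [] = refl
dualPivot-twist M (x ∷ X) (true ∷ Y) = begin
  dualPivot (twist M ⊤) (x ∷ X) (true ∷ Y)  ≡⟨ pivot-inside (twist M ⊤) x X Y ⟩
  dualPivot (twist (M ↓ false) ⊤) X Y       ≡⟨ dualPivot-twist (M ↓ false) X Y ⟩
  loopCompl (M ↓ false) X (Y △ ⊤)           ≡⟨ loop-outside M x X (Y △ ⊤) ⟨
  loopCompl M (x ∷ X) (false ∷ (Y △ ⊤)) ∎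
dualPivot-twist M (x ∷ X) (false ∷ Y) = begin
  dualPivot (twist M ⊤) (x ∷ X) (false ∷ Y)
    ≡⟨ pivot-outside (twist M ⊤) x X Y ⟩
  dualPivot (twist (M ↓ true) ⊤) X Y xor (x ∧ dualPivot (twist (M ↓ false) ⊤) X Y)
    ≡⟨ cong₂ (λ a b → a xor (x ∧ b)) (dualPivot-twist (M ↓ true) X Y) (dualPivot-twist (M ↓ false) X Y) ⟩
  loopCompl (M ↓ true) X (Y △ ⊤) xor (x ∧ loopCompl (M ↓ false) X (Y △ ⊤))
    ≡⟨ loop-inside M x X (Y △ ⊤) ⟨
  loopCompl M (x ∷ X) (true ∷ (Y △ ⊤)) ∎

△⊤-involutive : ∀ {n} (Y : Subset n) → (Y △ ⊤) △ ⊤ ≡ Y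
△⊤-involutive [] = refl
△⊤-involutive (true ∷ Y) = cong (true ∷_) (△⊤-involutive Y)
△⊤-involutive (false ∷ Y) = cong (false ∷_) (△⊤-involutive Y)

complement-size : ∀ {n} (Y : Subset n) → ∣ Y △ ⊤ ∣ + ∣ Y ∣ ≡ n
complement-size [] = refl
complement-size (true ∷ Y) = trans (ℕ.+-suc _ _) (cong suc (complement-size Y))
complement-size (false ∷ Y) = cong suc (complement-size Y)

complement-antitone : ∀ {n} (Y Z : Subset n) → ∣ Z △ ⊤ ∣ ≤ ∣ Y △ ⊤ ∣ → ∣ Y ∣ ≤ ∣ Z ∣
complement-antitone Y Z le = ℕ.+-cancelˡ-≤ (∣ Z △ ⊤ ∣) (∣ Y ∣) (∣ Z ∣)
  (ℕ.≤-trans (ℕ.+-monoˡ-≤ ∣ Y ∣ le)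
             (ℕ.≤-reflexive (trans (complement-size Y) (sym (complement-size Z)))))

-- Y ⊆ Y and Y ∖ X ⊆ Y, so Y itself is counted in (M + X)(Y) when Y ∈ M.
⊆ᵇ-refl : ∀ {n} (Y : Subset n) → (Y ⊆ᵇ Y) ≡ true
⊆ᵇ-refl [] = refl
⊆ᵇ-refl (true ∷ Y) = ⊆ᵇ-refl Y
⊆ᵇ-refl (false ∷ Y) = ⊆ᵇ-refl Y

─-⊆ᵇ : ∀ {n} (Y X : Subset n) → ((Y ─ X) ⊆ᵇ Y) ≡ true
─-⊆ᵇ [] [] = refl
─-⊆ᵇ (y ∷ Y) (true ∷ X) = ─-⊆ᵇ Y X
─-⊆ᵇ (true ∷ Y) (false ∷ X) = ─-⊆ᵇ Y X
─-⊆ᵇ (false ∷ Y) (false ∷ X) = ─-⊆ᵇ Y X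

⊆ᵇ-size : ∀ {n} (W Y : Subset n) → (W ⊆ᵇ Y) ≡ true → ∣ W ∣ ≤ ∣ Y ∣
⊆ᵇ-size [] [] W⊆Y = z≤n
⊆ᵇ-size (true ∷ W) (true ∷ Y) W⊆Y = s≤s (⊆ᵇ-size W Y W⊆Y)
⊆ᵇ-size (false ∷ W) (true ∷ Y) W⊆Y = ℕ.m≤n⇒m≤1+n (⊆ᵇ-size W Y W⊆Y)
⊆ᵇ-size (false ∷ W) (false ∷ Y) W⊆Y = ⊆ᵇ-size W Y W⊆Y

⊆ᵇ-size-eq : ∀ {n} (W Y : Subset n) → (W ⊆ᵇ Y) ≡ true → ∣ Y ∣ ≤ ∣ W ∣ → W ≡ Y
⊆ᵇ-size-eq [] [] W⊆Y le = refl
⊆ᵇ-size-eq (true ∷ W) (true ∷ Y) W⊆Y (s≤s le) = cong (true ∷_) (⊆ᵇ-size-eq W Y W⊆Y le)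
⊆ᵇ-size-eq (false ∷ W) (true ∷ Y) W⊆Y le = ⊥-elim (ℕ.<⇒≱ (s≤s (⊆ᵇ-size W Y W⊆Y)) le)
⊆ᵇ-size-eq (false ∷ W) (false ∷ Y) W⊆Y le = cong (false ∷_) (⊆ᵇ-size-eq W Y W⊆Y le)

-- Loop complementation of systems of constant rank

Rank : ∀ {n} → SetSys n → ℕ → Set
Rank M r = ∀ W → M W ≡ true → ∣ W ∣ ≡ r

-- Loop complementation of a rank-r system does not change membership of sets
-- with at most r elements: among the W with Y ∖ X ⊆ W ⊆ Y only Y can be a member.
loopCompl-small : ∀ {n r} {M : SetSys n} → Rank M r → ∀ X Y → ∣ Y ∣ ≤ r → loopCompl M X Y ≡ M Y
loopCompl-small {M = M} rank X Y |Y|≤r = trans (oddCount-unique (loopTerms M X Y) Y others) counted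
  where
  counted : M Y ∧ ((Y ─ X) ⊆ᵇ Y) ∧ (Y ⊆ᵇ Y) ≡ M Y
  counted rewrite ─-⊆ᵇ Y X | ⊆ᵇ-refl Y = ∧-identityʳ (M Y)
  others : ∀ W → W ≢ Y → M W ∧ ((Y ─ X) ⊆ᵇ W) ∧ (W ⊆ᵇ Y) ≡ false
  others W W≢Y with M W in W∈M | W ⊆ᵇ Y in W⊆Y
  ... | false | _ = refl
  ... | true | false = ∧-zeroʳ _
  ... | true | true = ⊥-elim (W≢Y (⊆ᵇ-size-eq W Y W⊆Y (subst (∣ Y ∣ ≤_) (sym (rank W W∈M)) |Y|≤r)))

loopCompl-fixed : ∀ {n r} {M : SetSys n} → Rank M r → ∀ X →
  (∀ Y → loopCompl M X Y ≡ true → ∣ Y ∣ ≤ r) → ∀ Y → loopCompl M X Y ≡ M Y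
loopCompl-fixed {r = r} {M} rank X small Y with ∣ Y ∣ ≤? r
... | yes |Y|≤r = loopCompl-small rank X Y |Y|≤r
... | no |Y|≰r = trans (¬-not (|Y|≰r ∘ small Y)) (sym (¬-not (|Y|≰r ∘ ℕ.≤-reflexive ∘ rank Y)))

allSubsets-complete : ∀ {n} (Y : Subset n) → Y ∈ allSubsets n
allSubsets-complete [] = here refl
allSubsets-complete (true ∷ Y) = ∈-++⁺ˡ (∈-map⁺ (true ∷_) (allSubsets-complete Y))
allSubsets-complete {suc n} (false ∷ Y) =
  ∈-++⁺ʳ (map (true ∷_) (allSubsets n)) (∈-map⁺ (false ∷_) (allSubsets-complete Y))

-- The least size of a member of N listed in l, or c if there is none;
-- by definition  dmin N = minSize N n (allSubsets n).
minSize : ∀ {n} → SetSys n → ℕ → List (Subset n) → ℕ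
minSize N c = foldr (λ Y acc → if N Y then ∣ Y ∣ ⊓ acc else acc) c

minSize-≤ : ∀ {n} (N : SetSys n) c {l Y} → Y ∈ l → N Y ≡ true → minSize N c l ≤ ∣ Y ∣
minSize-≤ N c {Y ∷ l} (here refl) Y∈N rewrite Y∈N = ℕ.m⊓n≤m ∣ Y ∣ _
minSize-≤ N c {W ∷ l} (there Y∈l) Y∈N = ℕ.≤-trans (step-≤ (N W)) (minSize-≤ N c Y∈l Y∈N)
  where
  step-≤ : ∀ b → (if b then ∣ W ∣ ⊓ minSize N c l else minSize N c l) ≤ minSize N c l
  step-≤ true = ℕ.m⊓n≤n ∣ W ∣ _
  step-≤ false = ℕ.≤-refl

minSize-≥ : ∀ {n} (N : SetSys n) {b c} l → b ≤ c → (∀ Y → N Y ≡ true → b ≤ ∣ Y ∣) → b ≤ minSize N c l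
minSize-≥ N [] b≤c lower = b≤c
minSize-≥ N (Y ∷ l) b≤c lower with N Y in Y∈N
... | true = ℕ.⊓-glb (lower Y Y∈N) (minSize-≥ N l b≤c lower)
... | false = minSize-≥ N l b≤c lower

minSize-cong : ∀ {n} {N N′ : SetSys n} c l → (∀ Y → N Y ≡ N′ Y) → minSize N c l ≡ minSize N′ c l
minSize-cong c [] N≗N′ = refl
minSize-cong c (Y ∷ l) N≗N′ rewrite N≗N′ Y | minSize-cong c l N≗N′ = refl

dmin-≤ : ∀ {n} (N : SetSys n) {Y} → N Y ≡ true → dmin N ≤ ∣ Y ∣
dmin-≤ {n} N {Y} = minSize-≤ N n (allSubsets-complete Y)

dmin-≥ : ∀ {n} (N : SetSys n) {b Y} → N Y ≡ true → (∀ W → N W ≡ true → b ≤ ∣ W ∣) → b ≤ dmin N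
dmin-≥ {n} N {Y = Y} Y∈N lower = minSize-≥ N (allSubsets n) (ℕ.≤-trans (lower Y Y∈N) (∣p∣≤n Y)) lower

dmin-cong : ∀ {n} {N N′ : SetSys n} → (∀ Y → N Y ≡ N′ Y) → dmin N ≡ dmin N′
dmin-cong {n} = minSize-cong n (allSubsets n)

nonempty-cong : ∀ {n} {N N′ : SetSys n} → (∀ Y → N Y ≡ N′ Y) → nonemptyᵇ N ≡ nonemptyᵇ N′
nonempty-cong {n} N≗N′ = cong or (map-cong N≗N′ (allSubsets n))

any-member : ∀ {A : Set} (p : A → Bool) {l x} → x ∈ l → p x ≡ true → any p l ≡ true
any-member p (here refl) px rewrite px = refl
any-member p {y ∷ l} (there x∈l) px rewrite any-member p x∈l px = ∨-zeroʳ (p y)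

nonempty-member : ∀ {n} (N : SetSys n) {Y} → N Y ≡ true → nonemptyᵇ N ≡ true
nonempty-member N {Y} = any-member N (allSubsets-complete Y)

-- Sums over all subsets

sumSubsets : ∀ {n} → (Subset n → ℤ) → ℤ
sumSubsets {n} f = sumℤ (map f (allSubsets n))

sumℤ-++ : ∀ xs ys → sumℤ (xs ++ ys) ≡ sumℤ xs ℤ.+ sumℤ ys
sumℤ-++ [] ys = sym (ℤ.+-identityˡ _)
sumℤ-++ (x ∷ xs) ys = trans (cong (λ s → x ℤ.+ s) (sumℤ-++ xs ys)) (sym (ℤ.+-assoc x _ _))

sum-neg : ∀ {A : Set} (f : A → ℤ) l → sumℤ (map (λ x → - f x) l) ≡ - sumℤ (map f l)
sum-neg f [] = refl
sum-neg f (x ∷ l) = trans (cong (λ s → - f x ℤ.+ s) (sum-neg f l)) (sym (ℤ.neg-distrib-+ (f x) _))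

sum-nonneg : ∀ {A : Set} (f : A → ℤ) → (∀ x → + 0 ℤ.≤ f x) → ∀ l → + 0 ℤ.≤ sumℤ (map f l)
sum-nonneg f nonneg [] = ℤ.≤-refl
sum-nonneg f nonneg (x ∷ l) = ℤ.+-mono-≤ (nonneg x) (sum-nonneg f nonneg l)

term≤sum : ∀ {A : Set} (f : A → ℤ) → (∀ x → + 0 ℤ.≤ f x) → ∀ {l x} → x ∈ l → f x ℤ.≤ sumℤ (map f l)
term≤sum f nonneg {x ∷ l} (here refl) =
  subst (ℤ._≤ f x ℤ.+ sumℤ (map f l)) (ℤ.+-identityʳ (f x)) (ℤ.+-monoʳ-≤ (f x) (sum-nonneg f nonneg l))
term≤sum f nonneg {y ∷ l} (there x∈l) = ℤ.≤-trans (term≤sum f nonneg x∈l)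
  (subst (ℤ._≤ f y ℤ.+ sumℤ (map f l)) (ℤ.+-identityˡ _) (ℤ.+-monoˡ-≤ (sumℤ (map f l)) (nonneg y)))

sumSubsets-split : ∀ {n} (f : Subset (suc n) → ℤ) →
  sumSubsets f ≡ sumSubsets (λ X → f (true ∷ X)) ℤ.+ sumSubsets (λ X → f (false ∷ X))
sumSubsets-split {n} f = begin
  sumℤ (map f (map (true ∷_) subsets ++ map (false ∷_) subsets))
    ≡⟨ cong sumℤ (map-++ f (map (true ∷_) subsets) _) ⟩
  sumℤ (map f (map (true ∷_) subsets) ++ map f (map (false ∷_) subsets))
    ≡⟨ sumℤ-++ (map f (map (true ∷_) subsets)) _ ⟩
  sumℤ (map f (map (true ∷_) subsets)) ℤ.+ sumℤ (map f (map (false ∷_) subsets))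
    ≡⟨ cong₂ ℤ._+_ (cong sumℤ (map-∘ subsets)) (cong sumℤ (map-∘ subsets)) ⟨
  sumSubsets (λ X → f (true ∷ X)) ℤ.+ sumSubsets (λ X → f (false ∷ X)) ∎
  where
  subsets : List (Subset n)
  subsets = allSubsets n

-- Translation X ↦ X₀ △ X permutes the subsets, so it does not change sums.
sumSubsets-translate : ∀ {n} (X₀ : Subset n) (f : Subset n → ℤ) → sumSubsets (λ X → f (X₀ △ X)) ≡ sumSubsets f
sumSubsets-translate [] f = refl
sumSubsets-translate (true ∷ X₀) f = begin
  sumSubsets (λ X → f ((true ∷ X₀) △ X))
    ≡⟨ sumSubsets-split (λ X → f ((true ∷ X₀) △ X)) ⟩
  sumSubsets (λ X → f (false ∷ (X₀ △ X))) ℤ.+ sumSubsets (λ X → f (true ∷ (X₀ △ X)))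
    ≡⟨ cong₂ ℤ._+_ (sumSubsets-translate X₀ (λ X → f (false ∷ X))) (sumSubsets-translate X₀ (λ X → f (true ∷ X))) ⟩
  sumSubsets (λ X → f (false ∷ X)) ℤ.+ sumSubsets (λ X → f (true ∷ X))
    ≡⟨ ℤ.+-comm (sumSubsets (λ X → f (false ∷ X))) _ ⟩
  sumSubsets (λ X → f (true ∷ X)) ℤ.+ sumSubsets (λ X → f (false ∷ X))
    ≡⟨ sumSubsets-split f ⟨
  sumSubsets f ∎
sumSubsets-translate (false ∷ X₀) f = begin
  sumSubsets (λ X → f ((false ∷ X₀) △ X))
    ≡⟨ sumSubsets-split (λ X → f ((false ∷ X₀) △ X)) ⟩
  sumSubsets (λ X → f (true ∷ (X₀ △ X))) ℤ.+ sumSubsets (λ X → f (false ∷ (X₀ △ X)))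
    ≡⟨ cong₂ ℤ._+_ (sumSubsets-translate X₀ (λ X → f (true ∷ X))) (sumSubsets-translate X₀ (λ X → f (false ∷ X))) ⟩
  sumSubsets (λ X → f (true ∷ X)) ℤ.+ sumSubsets (λ X → f (false ∷ X))
    ≡⟨ sumSubsets-split f ⟨
  sumSubsets f ∎

self-negative : ∀ (z : ℤ) → z ≡ - z → z ≡ + 0
self-negative (+ zero) _ = refl
self-negative (+ suc k) ()
self-negative -[1+ k ] ()

sumSubsets-antisymmetric : ∀ {n} (X₀ : Subset n) (f : Subset n → ℤ) →
  (∀ X → f (X₀ △ X) ≡ - f X) → sumSubsets f ≡ + 0
sumSubsets-antisymmetric {n} X₀ f flip = self-negative (sumSubsets f) (begin
  sumSubsets f                       ≡⟨ sumSubsets-translate X₀ f ⟨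
  sumSubsets (λ X → f (X₀ △ X))      ≡⟨ cong sumℤ (map-cong flip (allSubsets n)) ⟩
  sumSubsets (λ X → - f X)           ≡⟨ sum-neg f (allSubsets n) ⟩
  - sumSubsets f ∎)

isOdd : ℕ → Bool
isOdd zero = false
isOdd (suc k) = not (isOdd k)

%2-isOdd : ∀ k → k % 2 ≡ (if isOdd k then 1 else 0)
%2-isOdd zero = refl
%2-isOdd (suc zero) = refl
%2-isOdd (suc (suc k)) = begin
  (2 + k) % 2                             ≡⟨ cong (_% 2) (ℕ.+-comm 2 k) ⟩
  (k + 2) % 2                             ≡⟨ [m+n]%n≡m%n k 2 ⟩
  k % 2                                   ≡⟨ %2-isOdd k ⟩
  (if isOdd k then 1 else 0)              ≡⟨ cong (λ b → if b then 1 else 0) (not-involutive (isOdd k)) ⟨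
  (if not (not (isOdd k)) then 1 else 0) ∎

isOdd⇒%2≡1 : ∀ k → isOdd k ≡ true → k % 2 ≡ 1
isOdd⇒%2≡1 k odd = trans (%2-isOdd k) (cong (λ b → if b then 1 else 0) odd)

%2≡1⇒isOdd : ∀ k → k % 2 ≡ 1 → isOdd k ≡ true
%2≡1⇒isOdd k odd = ¬-not {y = false} (λ even → contradiction (trans (sym (trans (%2-isOdd k) (cong (λ b → if b then 1 else 0) even))) odd) λ ())

isOdd-△ : ∀ {n} (X Y : Subset n) → isOdd ∣ X △ Y ∣ ≡ isOdd ∣ X ∣ xor isOdd ∣ Y ∣
isOdd-△ [] [] = refl
isOdd-△ (true ∷ X) (true ∷ Y) = trans (isOdd-△ X Y) (not-xor-not (isOdd ∣ X ∣) (isOdd ∣ Y ∣))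
  where
  not-xor-not : ∀ a b → a xor b ≡ not a xor not b
  not-xor-not a b = trans (sym (not-involutive (a xor b)))
    (trans (cong not (not-distribʳ-xor a b)) (not-distribˡ-xor a (not b)))
isOdd-△ (true ∷ X) (false ∷ Y) = trans (cong not (isOdd-△ X Y)) (not-distribˡ-xor (isOdd ∣ X ∣) _)
isOdd-△ (false ∷ X) (true ∷ Y) = trans (cong not (isOdd-△ X Y)) (not-distribʳ-xor (isOdd ∣ X ∣) _)
isOdd-△ (false ∷ X) (false ∷ Y) = isOdd-△ X Y

signOf : Bool → ℤ
signOf b = if b then - (+ 1) else + 1

sign-isOdd : ∀ {n} (X : Subset n) → sign X ≡ signOf (isOdd ∣ X ∣)
sign-isOdd X = trans (cong (λ k → if k ≡ᵇ 0 then + 1 else - (+ 1)) (%2-isOdd ∣ X ∣)) (by-parity (isOdd ∣ X ∣))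
  where
  by-parity : ∀ b → (if (if b then 1 else 0) ≡ᵇ 0 then + 1 else - (+ 1)) ≡ signOf b
  by-parity true = refl
  by-parity false = refl

sign-even : ∀ {n} (X : Subset n) → ∣ X ∣ % 2 ≢ 1 → sign X ≡ + 1
sign-even X even = trans (sign-isOdd X) (cong signOf (¬-not (even ∘ isOdd⇒%2≡1 ∣ X ∣)))

sign-flip : ∀ {n} (X₀ X : Subset n) → isOdd ∣ X₀ ∣ ≡ true → sign (X₀ △ X) ≡ - sign X
sign-flip X₀ X odd = begin
  sign (X₀ △ X)               ≡⟨ sign-isOdd (X₀ △ X) ⟩
  signOf (isOdd ∣ X₀ △ X ∣)   ≡⟨ cong signOf (trans (isOdd-△ X₀ X) (cong (_xor isOdd ∣ X ∣) odd)) ⟩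
  signOf (not (isOdd ∣ X ∣))  ≡⟨ signOf-not (isOdd ∣ X ∣) ⟩
  - signOf (isOdd ∣ X ∣)      ≡⟨ cong -_ (sign-isOdd X) ⟨
  - sign X ∎
  where
  signOf-not : ∀ b → signOf (not b) ≡ - signOf b
  signOf-not true = refl
  signOf-not false = refl

allSubsets? : ∀ {n} {P : Subset n → Set} → (∀ X → Dec (P X)) → Dec (∀ X → P X)
allSubsets? P? with anySubset? (λ X → ¬? (P? X))
... | yes (X , ¬PX) = no (λ ∀P → ¬PX (∀P X))
... | no ¬∃¬P = yes (λ X → decidable-stable (P? X) (λ ¬PX → ¬∃¬P (X , ¬PX)))

-- The Penrose polynomial of a set system

module Penrose {n} (M : SetSys n) where

  termSystem : Subset n → SetSys n
  termSystem X = dualPivot (twist M ⊤) X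

  -- The contribution of the X-th term to the coefficient of y^k; by definition
  -- penroseCoeff M k ≡ sumSubsets (contribution k).
  contribution : ℕ → Subset n → ℤ
  contribution k X = if nonemptyᵇ (termSystem X) ∧ (dmin (termSystem X) ≡ᵇ k) then sign X else + 0

  OddSymmetry : Set
  OddSymmetry = ∃ λ (X : Subset n) → (∣ X ∣ % 2 ≡ 1) × (∀ Y → loopCompl M X Y ≡ M Y)

  -- (iii) ⇒ (i), for an arbitrary set system: X ↦ X₀ △ X pairs off terms of opposite sign.
  symmetric⇒vanishing : OddSymmetry → PenroseZero M
  symmetric⇒vanishing (X₀ , odd , fixed) k = sumSubsets-antisymmetric X₀ (contribution k) flip
    where
    same-system : ∀ X Y → termSystem (X₀ △ X) Y ≡ termSystem X Y
    same-system X Y = begin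
      termSystem (X₀ △ X) Y                ≡⟨ dualPivot-twist M (X₀ △ X) Y ⟩
      loopCompl M (X₀ △ X) (Y △ ⊤)         ≡⟨ loopCompl-∘ M X₀ X (Y △ ⊤) ⟨
      loopCompl (loopCompl M X₀) X (Y △ ⊤) ≡⟨ loopCompl-cong fixed X (Y △ ⊤) ⟩
      loopCompl M X (Y △ ⊤)                ≡⟨ dualPivot-twist M X Y ⟨
      termSystem X Y ∎
    negate-if : ∀ b s → (if b then - s else + 0) ≡ - (if b then s else + 0)
    negate-if true s = refl
    negate-if false s = refl
    flip : ∀ X → contribution k (X₀ △ X) ≡ - contribution k X
    flip X = trans
      (cong₂ (λ b s → if b then s else + 0)
             (cong₂ _∧_ (nonempty-cong (same-system X)) (cong (_≡ᵇ k) (dmin-cong (same-system X))))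
             (sign-flip X₀ X (%2≡1⇒isOdd ∣ X₀ ∣ odd)))
      (negate-if (nonemptyᵇ (termSystem X) ∧ (dmin (termSystem X) ≡ᵇ k)) (sign X))

  module Equicardinal-case {Y₀ : Subset n} (Y₀∈M : M Y₀ ≡ true) (equi : Equicardinal M) where

    rank : Rank M ∣ Y₀ ∣
    rank W W∈M = equi W Y₀ W∈M Y₀∈M

    m : ℕ
    m = dmin (twist M ⊤)

    -- The members of M * V are the complements of members of M, so d_{M*V} = |V ∖ Y₀|.
    m-lower : ∣ Y₀ △ ⊤ ∣ ≤ m
    m-lower = dmin-≥ (twist M ⊤) (trans (cong M (△⊤-involutive Y₀)) Y₀∈M) λ W W∈M*V →
      complement-antitone (Y₀ △ ⊤) W
        (ℕ.≤-reflexive (trans (rank (W △ ⊤) W∈M*V) (cong ∣_∣ (sym (△⊤-involutive Y₀)))))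

    -- A term of degree m has M + X = M: each member Y of M + X gives the member
    -- V ∖ Y of the term's set system, so |V ∖ Y| ≥ m ≥ |V ∖ Y₀|, i.e. |Y| ≤ |Y₀|.
    degree-m⇒fixed : ∀ X → dmin (termSystem X) ≡ m → ∀ Y → loopCompl M X Y ≡ M Y
    degree-m⇒fixed X degree = loopCompl-fixed rank X small
      where
      small : ∀ Y → loopCompl M X Y ≡ true → ∣ Y ∣ ≤ ∣ Y₀ ∣
      small Y Y∈M+X = complement-antitone Y Y₀
        (ℕ.≤-trans m-lower (subst (_≤ ∣ Y △ ⊤ ∣) degree (dmin-≤ (termSystem X) complement∈)))
        where
        complement∈ : termSystem X (Y △ ⊤) ≡ true
        complement∈ = trans (dualPivot-twist M X (Y △ ⊤)) (trans (cong (loopCompl M X) (△⊤-involutive Y)) Y∈M+X)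

    empty-contribution : contribution m ∅ ≡ + 1
    empty-contribution = trans (cong (λ b → if b then sign (∅ {n}) else + 0) contributes)
                               (cong (λ k → if k % 2 ≡ᵇ 0 then + 1 else - (+ 1)) (∣⊥∣≡0 n))
      where
      system-∅ : ∀ Y → termSystem ∅ Y ≡ twist M ⊤ Y
      system-∅ Y = trans (dualPivot-twist M ∅ Y) (loopCompl-∅ M (Y △ ⊤))
      contributes : nonemptyᵇ (termSystem ∅) ∧ (dmin (termSystem ∅) ≡ᵇ m) ≡ true
      contributes = cong₂ _∧_
        (trans (nonempty-cong system-∅) (nonempty-member (twist M ⊤) (trans (cong M (△⊤-involutive Y₀)) Y₀∈M)))
        (trans (cong (_≡ᵇ m) (dmin-cong system-∅)) (Equivalence.to T-≡ (ℕ.≡⇒≡ᵇ m m refl)))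

    -- Without odd symmetries, every term of degree m has even size, so contributes +1 or 0.
    contribution-nonneg : ¬ OddSymmetry → ∀ X → + 0 ℤ.≤ contribution m X
    contribution-nonneg none X with nonemptyᵇ (termSystem X) ∧ (dmin (termSystem X) ≡ᵇ m) in contributes
    ... | false = ℤ.≤-refl
    ... | true = subst (+ 0 ℤ.≤_) (sym (sign-even X even)) (ℤ.+≤+ z≤n)
      where
      degree : dmin (termSystem X) ≡ m
      degree = ℕ.≡ᵇ⇒≡ _ m (proj₂ (Equivalence.to T-∧ (Equivalence.from T-≡ contributes)))
      even : ∣ X ∣ % 2 ≢ 1
      even odd = none (X , odd , degree-m⇒fixed X degree)

    coefficient-positive : ¬ OddSymmetry → + 1 ℤ.≤ penroseCoeff M m
    coefficient-positive none = subst (ℤ._≤ penroseCoeff M m) empty-contribution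
      (term≤sum (contribution m) (contribution-nonneg none) (allSubsets-complete ∅))

    odd-symmetry? : Dec OddSymmetry
    odd-symmetry? = anySubset? λ X →
      (∣ X ∣ % 2 ℕ.≟ 1) ×-dec allSubsets? (λ Y → loopCompl M X Y Bool.≟ M Y)

    low-degree⇒symmetric : PenroseDegLt M m → OddSymmetry
    low-degree⇒symmetric low with odd-symmetry?
    ... | yes symmetric = symmetric
    ... | no none = contradiction (subst (+ 1 ℤ.≤_) (low m ℕ.≤-refl) (coefficient-positive none))
                                  λ { (ℤ.+≤+ ()) }

theorem6 : ∀ {n} (M : SetSys n) → Proper M → Equicardinal M →
    (PenroseZero M ⇔ PenroseDegLt M (dmin (twist M ⊤)))
    × (PenroseZero M ⇔ (∃ λ (X : Subset n) → (∣ X ∣ % 2 ≡ 1) × (∀ Y → loopCompl M X Y ≡ M Y)))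
theorem6 M (Y₀ , Y₀∈M) equi =
  mk⇔ (λ vanishing k _ → vanishing k) (symmetric⇒vanishing ∘ low-degree⇒symmetric) ,
  mk⇔ (λ vanishing → low-degree⇒symmetric (λ k _ → vanishing k)) symmetric⇒vanishing
  where
  open Penrose M
  open Equicardinal-case Y₀∈M equi
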